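{- Let $N$ be a positive integer. If two multisets $A,B$ supported on $[N]$ satisfy $\mathcal{S}^*(A)\cap\mathcal{S}^*(B)=\emptyset$ and $|\Sigma(A)-\Sigma(B)|<N$, then $|A|+|B|\le 2N$.
   Context: A multiset $X$ of integers is supported on $[N]=\{1,\dots,N\}$ if every element of $X$ lies in $[N]$. $|X|$ is the size of $X$ counted with multiplicity, and $\Sigma(X)$ is the sum of its elements counted with multiplicity. $\mathcal{S}^*(X)$ denotes the set of sums $\Sigma(Y)$ over all non-empty sub-multisets $Y\subseteq X$. -}

module Defs where

open import Data.Nat using (ℕ; _≤_; _<_; _+_; _*_)
open import Data.List using (List; []; _∷_; length)
open import Data.Nat.ListAction using (sum)
open import Data.List.Relation.Unary.All using (All)
open import Data.List.Relation.Binary.Sublist.Propositional using (_⊆_)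
open import Data.Product using (∃; _×_)
open import Relation.Binary.PropositionalEquality using (_≡_; _≢_)

-- A finite multiset of naturals is represented by a list (order irrelevant;
-- all notions below are invariant under permutation).

SupportedOn : ℕ → List ℕ → Set
SupportedOn N X = All (λ x → 1 ≤ x × x ≤ N) X

-- Sub-multisets of X correspond to sublists of X.
-- s ∈ S*(X) : s is the sum of some non-empty sub-multiset of X.
InSubsetSums : ℕ → List ℕ → Set
InSubsetSums s X = ∃ λ (Y : List ℕ) → Y ⊆ X × Y ≢ [] × sum Y ≡ s

-- Walk through A and B, always appending the next element to the side whose partial sum is
-- smaller (or the only side left).  The partial sums x, y then satisfy -N < x - y ≤ N at each
-- of the |A| + |B| + 1 states, so x - y takes at most 2N values.  If two states had the same
-- difference, the elements of A and of B added between them would be non-empty sub-multisets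
-- with equal sums.  Hence all differences are distinct and |A| + |B| + 1 ≤ 2N.
module Submission where

open import Defs
open import Data.Nat using (ℕ; _≤_; _<_; _+_; _*_; ∣_-_∣; suc; _∸_; z≤n)
open import Data.Nat.Properties
open import Data.List using (List; length; []; _∷_)
open import Data.Nat.ListAction using (sum)
open import Data.Empty using (⊥)
open import Data.Product using (_×_; _,_; proj₁; proj₂)
open import Data.Sum using (_⊎_; inj₁; inj₂; [_,_]′)
open import Data.Vec using (Vec; []; _∷_)
open import Data.Vec.Relation.Unary.All as All using (All; []; _∷_)
open import Data.Vec.Relation.Unary.All.Properties using (lookup⁺)
open import Data.Vec.Relation.Unary.AllPairs using ([]; _∷_)
open import Data.Vec.Relation.Unary.Unique.Propositional using (Unique)
open import Data.Vec.Relation.Unary.Unique.Propositional.Properties using (lookup-injective)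
open import Data.Fin using (fromℕ<)
open import Data.Fin.Properties using (injective⇒≤; fromℕ<-injective)
open import Data.List.Relation.Unary.All using (_∷_)
open import Data.List.Relation.Binary.Sublist.Propositional using (_⊆_; _∷_; _∷ʳ_; minimum)
open import Function using (id)
open import Relation.Binary.PropositionalEquality hiding ([_])

bounded-unique⇒≤ : ∀ {n M} {xs : Vec ℕ n} → Unique xs → All (_< M) xs → n ≤ M
bounded-unique⇒≤ xs! xs<M = injective⇒≤ {f = λ i → fromℕ< (lookup⁺ xs<M i)} λ {i} {j} eq →
  lookup-injective xs! i j (fromℕ<-injective _ _ (lookup⁺ xs<M i) (lookup⁺ xs<M j) eq)

∣-∣<⇒< : ∀ {x y N} → ∣ x - y ∣ < N → y < x + N
∣-∣<⇒< {x} {y} {N} h = begin-strict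
  y             ≤⟨ m≤n+m∸n y x ⟩
  x + (y ∸ x)   <⟨ +-monoʳ-< x (≤-<-trans (m∸n≤∣m-n∣ y x) (subst (_< N) (∣-∣-comm x y) h)) ⟩
  x + N         ∎
  where open ≤-Reasoning

0<sum⇒≢[] : ∀ (P : List ℕ) → 0 < sum P → P ≢ []
0<sum⇒≢[] (_ ∷ _) _ ()

SubsetSumsDisjoint : List ℕ → List ℕ → Set
SubsetSumsDisjoint as bs = (s : ℕ) → InSubsetSums s as → InSubsetSums s bs → ⊥

InSubsetSums-∷ʳ : ∀ {s} a {as} → InSubsetSums s as → InSubsetSums s (a ∷ as)
InSubsetSums-∷ʳ a (Y , Y⊆as , Y≢[] , ΣY≡s) = Y , a ∷ʳ Y⊆as , Y≢[] , ΣY≡s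

SubsetSumsDisjoint-dropˡ : ∀ {a as bs} → SubsetSumsDisjoint (a ∷ as) bs → SubsetSumsDisjoint as bs
SubsetSumsDisjoint-dropˡ {a} disj s sa sb = disj s (InSubsetSums-∷ʳ a sa) sb

SubsetSumsDisjoint-dropʳ : ∀ {b as bs} → SubsetSumsDisjoint as (b ∷ bs) → SubsetSumsDisjoint as bs
SubsetSumsDisjoint-dropʳ {b} disj s sa sb = disj s sa (InSubsetSums-∷ʳ b sb)

-- The key of a balanced state (x, y) encodes x - y ∈ (-N, N] as a number in [0, 2N); IsKey
-- characterises it without truncated subtraction.
Balanced : ℕ → ℕ → ℕ → Set
Balanced N x y = y < x + N × x ≤ y + N

IsKey : ℕ → ℕ → ℕ → ℕ → Set
IsKey N x y k = k + suc y ≡ N + x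

key : ℕ → ℕ → ℕ → ℕ
key N x y = N + x ∸ suc y

key-isKey : ∀ {N x y} → Balanced N x y → IsKey N x y (key N x y)
key-isKey {N} {x} {y} (y<x+N , _) = m∸n+n≡m (subst (suc y ≤_) (+-comm x N) y<x+N)

key<N+N : ∀ {N x y} → Balanced N x y → key N x y < N + N
key<N+N {N} {x} {y} bal@(_ , x≤y+N) = +-cancelʳ-≤ y (suc (key N x y)) (N + N) (begin
  suc (key N x y) + y   ≡⟨ +-suc (key N x y) y ⟨
  key N x y + suc y     ≡⟨ key-isKey bal ⟩
  N + x                 ≤⟨ +-monoʳ-≤ N x≤y+N ⟩
  N + (y + N)           ≡⟨ cong (N +_) (+-comm y N) ⟩
  N + (N + y)           ≡⟨ +-assoc N N y ⟨
  N + N + y             ∎)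
  where open ≤-Reasoning

IsKey-cancel : ∀ {N x y k} p q → IsKey N x y k → IsKey N (x + p) (y + q) k → q ≡ p
IsKey-cancel {N} {x} {y} {k} p q e e′ = +-cancelˡ-≡ (N + x) q p (begin
  N + x + q         ≡⟨ cong (_+ q) e ⟨
  k + suc y + q     ≡⟨ +-assoc k (suc y) q ⟩
  k + suc (y + q)   ≡⟨ e′ ⟩
  N + (x + p)       ≡⟨ +-assoc N x p ⟨
  N + x + p         ∎)
  where open ≡-Reasoning

data Reach (N x y : ℕ) (as bs : List ℕ) (k : ℕ) : Set where
  reach : ∀ {P Q} → P ⊆ as → Q ⊆ bs → IsKey N (x + sum P) (y + sum Q) k → Reach N x y as bs k

data Reach⁺ (N x y : ℕ) (as bs : List ℕ) (k : ℕ) : Set where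
  reach⁺ : ∀ {P Q} → P ⊆ as → Q ⊆ bs → 0 < sum P ⊎ 0 < sum Q →
           IsKey N (x + sum P) (y + sum Q) k → Reach⁺ N x y as bs k

Reach⁺⇒Reach : ∀ {N x y as bs k} → Reach⁺ N x y as bs k → Reach N x y as bs k
Reach⁺⇒Reach (reach⁺ P⊆as Q⊆bs _ e) = reach P⊆as Q⊆bs e

Reach-here : ∀ {N x y k as bs} → IsKey N x y k → Reach N x y as bs k
Reach-here {N} {x} {y} {k} e =
  reach (minimum _) (minimum _)
        (subst₂ (λ u v → IsKey N u v k) (sym (+-identityʳ x)) (sym (+-identityʳ y)) e)

Reach-shiftˡ : ∀ {N x y a as bs k} → 0 < a → Reach N (x + a) y as bs k → Reach⁺ N x y (a ∷ as) bs k
Reach-shiftˡ {N} {x} {y} {a} {k = k} 0<a (reach {P} {Q} P⊆as Q⊆bs e) =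
  reach⁺ (refl ∷ P⊆as) Q⊆bs (inj₁ (≤-trans 0<a (m≤m+n a (sum P))))
         (subst (λ u → IsKey N u (y + sum Q) k) (+-assoc x a (sum P)) e)

Reach-shiftʳ : ∀ {N x y b as bs k} → 0 < b → Reach N x (y + b) as bs k → Reach⁺ N x y as (b ∷ bs) k
Reach-shiftʳ {N} {x} {y} {b} {k = k} 0<b (reach {P} {Q} P⊆as Q⊆bs e) =
  reach⁺ P⊆as (refl ∷ Q⊆bs) (inj₂ (≤-trans 0<b (m≤m+n b (sum Q))))
         (subst (λ v → IsKey N (x + sum P) v k) (+-assoc y b (sum Q)) e)

-- Equal keys force the consumed parts to have equal, positive sums: a common subset sum.
Reach⁺-fresh : ∀ {N x y as bs k₀ k} → SubsetSumsDisjoint as bs → IsKey N x y k₀ →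
               Reach⁺ N x y as bs k → k₀ ≢ k
Reach⁺-fresh {N} {x} {y} disj e (reach⁺ {P} {Q} P⊆as Q⊆bs pos e′) refl =
  disj (sum P) (P , P⊆as , 0<sum⇒≢[] P 0<ΣP , refl) (Q , Q⊆bs , 0<sum⇒≢[] Q 0<ΣQ , ΣQ≡ΣP)
  where
  ΣQ≡ΣP : sum Q ≡ sum P
  ΣQ≡ΣP = IsKey-cancel {N} {x} {y} (sum P) (sum Q) e e′
  0<ΣP : 0 < sum P
  0<ΣP = [ id , subst (0 <_) ΣQ≡ΣP ]′ pos
  0<ΣQ : 0 < sum Q
  0<ΣQ = subst (0 <_) (sym ΣQ≡ΣP) 0<ΣP

record Keys (N x y : ℕ) (as bs : List ℕ) (n : ℕ) : Set where
  field
    keys           : Vec ℕ n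
    keys<N+N       : All (_< N + N) keys
    keys-unique    : Unique keys
    keys-reachable : All (Reach N x y as bs) keys
open Keys

Keys-[] : ∀ {N x y} → Balanced N x y → Keys N x y [] [] 1
Keys-[] bal = record
  { keys           = _ ∷ []
  ; keys<N+N       = key<N+N bal ∷ []
  ; keys-unique    = [] ∷ []
  ; keys-reachable = Reach-here (key-isKey bal) ∷ []
  }

Keys-step : ∀ {N x y x′ y′ as bs as′ bs′ n} → SubsetSumsDisjoint as bs → Balanced N x y →
            (∀ {k} → Reach N x′ y′ as′ bs′ k → Reach⁺ N x y as bs k) →
            Keys N x′ y′ as′ bs′ n → Keys N x y as bs (suc n)
Keys-step disj bal shift K = record
  { keys           = _ ∷ keys K
  ; keys<N+N       = key<N+N bal ∷ keys<N+N K
  ; keys-unique    = All.map (λ r → Reach⁺-fresh disj (key-isKey bal) (shift r)) (keys-reachable K)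
                     ∷ keys-unique K
  ; keys-reachable = Reach-here (key-isKey bal)
                     ∷ All.map (λ r → Reach⁺⇒Reach (shift r)) (keys-reachable K)
  }

Balanced-stepˡ : ∀ {N x y a} → Balanced N x y → x + a ≤ y + N → Balanced N (x + a) y
Balanced-stepˡ {N} {x} {a = a} (y<x+N , _) x+a≤y+N = <-≤-trans y<x+N (+-monoˡ-≤ N (m≤m+n x a)) , x+a≤y+N

Balanced-stepʳ : ∀ {N x y b} → Balanced N x y → y + b < x + N → Balanced N x (y + b)
Balanced-stepʳ {N} {y = y} {b} (_ , x≤y+N) y+b<x+N = y+b<x+N , ≤-trans x≤y+N (+-monoˡ-≤ N (m≤m+n y b))

-- Balance of the final state lets the walk continue once one of the lists is exhausted.
mutual
  walk : ∀ {N} as bs {x y} → SupportedOn N as → SupportedOn N bs → SubsetSumsDisjoint as bs →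
         Balanced N x y → Balanced N (x + sum as) (y + sum bs) →
         Keys N x y as bs (suc (length as + length bs))
  walk [] [] _ _ _ bal _ = Keys-[] bal
  walk {N} (a ∷ as) [] {x} {y} A B disj bal end = walkˡ a as [] A B disj bal end
    (≤-trans (+-monoʳ-≤ x (m≤m+n a (sum as))) (subst (λ v → _ ≤ v + N) (+-identityʳ y) (proj₂ end)))
  walk {N} [] (b ∷ bs) {x} {y} A B disj bal end = walkʳ [] b bs A B disj bal end
    (≤-<-trans (+-monoʳ-≤ y (m≤m+n b (sum bs))) (subst (λ u → _ < u + N) (+-identityʳ x) (proj₁ end)))
  walk (a ∷ as) (b ∷ bs) {x} {y} A@((_ , a≤N) ∷ _) B@((_ , b≤N) ∷ _) disj bal end =
    [ (λ x≤y → walkˡ a as (b ∷ bs) A B disj bal end (+-mono-≤ x≤y a≤N))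
    , (λ y<x → walkʳ (a ∷ as) b bs A B disj bal end (+-mono-<-≤ y<x b≤N))
    ]′ (≤-<-connex x y)

  walkˡ : ∀ {N} a as bs {x y} → SupportedOn N (a ∷ as) → SupportedOn N bs →
          SubsetSumsDisjoint (a ∷ as) bs → Balanced N x y → Balanced N (x + sum (a ∷ as)) (y + sum bs) →
          x + a ≤ y + N → Keys N x y (a ∷ as) bs (suc (length (a ∷ as) + length bs))
  walkˡ {N} a as bs {x} {y} ((1≤a , _) ∷ A) B disj bal end x+a≤y+N =
    Keys-step disj bal (Reach-shiftˡ 1≤a)
      (walk as bs A B (SubsetSumsDisjoint-dropˡ disj) (Balanced-stepˡ bal x+a≤y+N)
        (subst (λ u → Balanced N u (y + sum bs)) (sym (+-assoc x a (sum as))) end))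

  walkʳ : ∀ {N} as b bs {x y} → SupportedOn N as → SupportedOn N (b ∷ bs) →
          SubsetSumsDisjoint as (b ∷ bs) → Balanced N x y → Balanced N (x + sum as) (y + sum (b ∷ bs)) →
          y + b < x + N → Keys N x y as (b ∷ bs) (suc (length as + length (b ∷ bs)))
  walkʳ {N} as b bs {x} {y} A ((1≤b , _) ∷ B) disj bal end y+b<x+N =
    subst (Keys N x y as (b ∷ bs)) (cong suc (sym (+-suc (length as) (length bs))))
      (Keys-step disj bal (Reach-shiftʳ 1≤b)
        (walk as bs A B (SubsetSumsDisjoint-dropʳ disj) (Balanced-stepʳ bal y+b<x+N)
          (subst (λ v → Balanced N (x + sum as) v) (sym (+-assoc y b (sum bs))) end)))

lemma3p2 : (N : ℕ) → 1 ≤ N → (A B : List ℕ) →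
    SupportedOn N A → SupportedOn N B →
    ((s : ℕ) → InSubsetSums s A → InSubsetSums s B → ⊥) →
    ∣ sum A - sum B ∣ < N →
    length A + length B ≤ 2 * N
lemma3p2 N 1≤N A B A⊆[N] B⊆[N] disj ∣ΣA-ΣB∣<N = begin
  length A + length B         ≤⟨ n≤1+n _ ⟩
  suc (length A + length B)   ≤⟨ bounded-unique⇒≤ (keys-unique K) (keys<N+N K) ⟩
  N + N                       ≡⟨ cong (N +_) (+-identityʳ N) ⟨
  2 * N                       ∎
  where
  open ≤-Reasoning
  K : Keys N 0 0 A B (suc (length A + length B))
  K = walk A B A⊆[N] B⊆[N] disj (1≤N , z≤n)
        (∣-∣<⇒< ∣ΣA-ΣB∣<N , <⇒≤ (∣-∣<⇒< (subst (_< N) (∣-∣-comm (sum A) (sum B)) ∣ΣA-ΣB∣<N)))
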